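{- There is an absolute constant $C$ with the following property. Let $r$ be a non-negative integer, let $\mathcal{A}$ be an anticode of Manhattan diameter $r$ in the square grid, let $\ell$ be a positive integer with $\ell\le r$, and let $w$ be the number of Lee spheres of radius $\ell$ (with centres in $\mathbb{Z}^2$) that intersect $\mathcal{A}$ non-trivially. Then $w\le\frac12(r+2\ell)^2+Cr$.
   Context: The square grid is $\mathbb{Z}^2$ with Manhattan distance $d((i_1,j_1),(i_2,j_2))=|i_2-i_1|+|j_2-j_1|$. An anticode of diameter $r$ is a set of grid points with pairwise distances at most $r$. A Lee sphere of radius $\ell$ is the set of grid points at Manhattan distance at most $\ell$ from a centre point. -}

module Defs where

open import Level using (0ℓ)
open import Data.Nat using (ℕ; _+_; _≤_)
open import Data.Integer using (ℤ; ∣_∣; _-_)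
open import Data.Product using (_×_; _,_; ∃-syntax)
open import Relation.Unary using (Pred; _∈_)

Point : Set
Point = ℤ × ℤ

dist : Point → Point → ℕ
dist (i₁ , j₁) (i₂ , j₂) = ∣ i₂ - i₁ ∣ + ∣ j₂ - j₁ ∣

IsAnticode : ℕ → Pred Point 0ℓ → Set
IsAnticode r A = ∀ p q → p ∈ A → q ∈ A → dist p q ≤ r

LeeSphere : Point → ℕ → Pred Point 0ℓ
LeeSphere c ℓ p = dist c p ≤ ℓ

Meets : Point → ℕ → Pred Point 0ℓ → Set
Meets c ℓ A = ∃[ p ] (p ∈ A × p ∈ LeeSphere c ℓ)

-- Rotating the grid by 45 degrees, u = i + j and v = i - j are non-expanding for the Manhattan
-- metric, so a set of diameter D lies in a box [m, m + D] × [n, n + D] of (u, v)-coordinates;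
-- since u ≡ v (mod 2), a point is determined by its u-offset and the half of its v-offset,
-- whence at most (D + 1)(⌊D/2⌋ + 1) points. The centres of the Lee spheres meeting an
-- anticode of diameter r form a set of diameter at most r + 2ℓ, and
-- 2 (D + 1)(⌊D/2⌋ + 1) ≤ D² + 3D + 2 ≤ D² + 12r for D = r + 2ℓ and 1 ≤ ℓ ≤ r.
module Submission where

open import Defs
open import Level using (0ℓ)
open import Data.Nat using (ℕ; _+_; _*_; _≤_; _^_)
open import Data.Product using (∃-syntax)
open import Data.List using (List; length)
open import Data.List.Relation.Unary.All using (All)
open import Data.List.Relation.Unary.Unique.Propositional using (Unique)
open import Relation.Unary using (Pred)

open import Data.List.Relation.Unary.All using (_∷_)
open import Data.Nat using (suc; _<_; z≤n; s≤s)
open import Data.Nat.Properties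
  using (≤-trans; ≤-reflexive; +-mono-≤; +-monoʳ-≤; *-monoʳ-≤; *-comm; *-identityʳ; +-assoc; m≤m+n;
         module ≤-Reasoning)
open import Data.Nat.DivMod using (_/_; _%_; m≡m%n+[m/n]*n; [m+kn]%n≡m%n; /-monoˡ-≤; m/n*n≤m)
import Data.Nat.Tactic.RingSolver as ℕ-Solver
open import Data.Integer as ℤ using (ℤ; +_; -[1+_]; ∣_∣)
import Data.Integer.Properties as ℤ
import Data.Integer.Tactic.RingSolver as ℤ-Solver
open import Data.Fin using (Fin; fromℕ<; combine) renaming (zero to fzero; suc to fsuc)
open import Data.Fin.Properties using (fromℕ<-injective; combine-injective; injective⇒≤)
open import Data.Product using (_×_; _,_; proj₁; proj₂)
open import Data.Product.Properties using (,-injectiveˡ; ,-injectiveʳ)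
open import Data.Sum using (inj₁; inj₂)
open import Data.List using ([]; _∷_; lookup)
open import Data.List.Membership.Propositional using (_∈_)
open import Data.List.Membership.Propositional.Properties using (∈-lookup)
open import Data.List.Relation.Unary.Any using (here; there)
open import Data.List.Relation.Unary.AllPairs using (_∷_)
import Data.List.Relation.Unary.All as All
open import Data.List.Extrema ℤ.≤-totalOrder
  using (argmin; argmin-sel; f[argmin]≤f[⊤]; f[argmin]≤f[xs])
open import Function.Definitions using (Injective)
open import Relation.Nullary using (contradiction)
open import Relation.Binary.PropositionalEquality
  using (_≡_; refl; sym; trans; cong; cong₂; subst; module ≡-Reasoning)

∣i-k∣≤∣i-j∣+∣j-k∣ : ∀ i j k → ∣ i ℤ.- k ∣ ≤ ∣ i ℤ.- j ∣ + ∣ j ℤ.- k ∣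
∣i-k∣≤∣i-j∣+∣j-k∣ i j k = subst (λ d → ∣ d ∣ ≤ ∣ i ℤ.- j ∣ + ∣ j ℤ.- k ∣) (telescope i j k)
  (ℤ.∣i+j∣≤∣i∣+∣j∣ (i ℤ.- j) (j ℤ.- k))
  where
  telescope : ∀ i j k → (i ℤ.- j) ℤ.+ (j ℤ.- k) ≡ i ℤ.- k
  telescope = ℤ-Solver.solve-∀

dist-sym : ∀ p q → dist p q ≡ dist q p
dist-sym (i , j) (i' , j') = cong₂ _+_ (ℤ.∣i-j∣≡∣j-i∣ i' i) (ℤ.∣i-j∣≡∣j-i∣ j' j)

dist-triangle : ∀ p q s → dist p s ≤ dist p q + dist q s
dist-triangle (i₁ , j₁) (i₂ , j₂) (i₃ , j₃) = ≤-trans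
  (+-mono-≤ (∣i-k∣≤∣i-j∣+∣j-k∣ i₃ i₂ i₁) (∣i-k∣≤∣i-j∣+∣j-k∣ j₃ j₂ j₁))
  (≤-reflexive (interchange (∣ i₃ ℤ.- i₂ ∣) (∣ i₂ ℤ.- i₁ ∣) (∣ j₃ ℤ.- j₂ ∣) (∣ j₂ ℤ.- j₁ ∣)))
  where
  interchange : ∀ a b c d → (a + b) + (c + d) ≡ (b + d) + (a + c)
  interchange = ℕ-Solver.solve-∀

u v : Point → ℤ
u (i , j) = i ℤ.+ j
v (i , j) = i ℤ.- j

NonExpanding : (Point → ℤ) → Set
NonExpanding f = ∀ p q → ∣ f q ℤ.- f p ∣ ≤ dist p q

u-nonExpanding : NonExpanding u
u-nonExpanding (i , j) (i' , j') = subst (λ d → ∣ d ∣ ≤ dist (i , j) (i' , j')) (sym (regroup i j i' j'))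
  (ℤ.∣i+j∣≤∣i∣+∣j∣ (i' ℤ.- i) (j' ℤ.- j))
  where
  regroup : ∀ i j i' j' → (i' ℤ.+ j') ℤ.- (i ℤ.+ j) ≡ (i' ℤ.- i) ℤ.+ (j' ℤ.- j)
  regroup = ℤ-Solver.solve-∀

v-nonExpanding : NonExpanding v
v-nonExpanding (i , j) (i' , j') = subst (λ d → ∣ d ∣ ≤ dist (i , j) (i' , j')) (sym (regroup i j i' j'))
  (ℤ.∣i-j∣≤∣i∣+∣j∣ (i' ℤ.- i) (j' ℤ.- j))
  where
  regroup : ∀ i j i' j' → (i' ℤ.- j') ℤ.- (i ℤ.- j) ≡ (i' ℤ.- i) ℤ.- (j' ℤ.- j)
  regroup = ℤ-Solver.solve-∀

v-gap-on-u-line : ∀ {p q} → u p ≡ u q → v p ℤ.- v q ≡ + 2 ℤ.* (proj₁ p ℤ.- proj₁ q)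
v-gap-on-u-line {i , j} {i' , j'} u≡ = begin
  (i ℤ.- j) ℤ.- (i' ℤ.- j')                                  ≡⟨ expand i j i' j' ⟩
  + 2 ℤ.* (i ℤ.- i') ℤ.- ((i ℤ.+ j) ℤ.- (i' ℤ.+ j'))         ≡⟨ cong (λ w → + 2 ℤ.* (i ℤ.- i') ℤ.- (w ℤ.- (i' ℤ.+ j'))) u≡ ⟩
  + 2 ℤ.* (i ℤ.- i') ℤ.- ((i' ℤ.+ j') ℤ.- (i' ℤ.+ j'))       ≡⟨ drop (+ 2 ℤ.* (i ℤ.- i')) (i' ℤ.+ j') ⟩
  + 2 ℤ.* (i ℤ.- i')                                         ∎
  where
  open ≡-Reasoning
  expand : ∀ i j i' j' → (i ℤ.- j) ℤ.- (i' ℤ.- j') ≡ + 2 ℤ.* (i ℤ.- i') ℤ.- ((i ℤ.+ j) ℤ.- (i' ℤ.+ j'))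
  expand = ℤ-Solver.solve-∀
  drop : ∀ x y → x ℤ.- (y ℤ.- y) ≡ x
  drop = ℤ-Solver.solve-∀

u-v-injective : ∀ {p q} → u p ≡ u q → v p ≡ v q → p ≡ q
u-v-injective {i , j} {i' , j'} u≡ v≡ = cong₂ _,_ i≡i' (begin
  j                       ≡⟨ j-from-u i j ⟩
  (i ℤ.+ j) ℤ.- i         ≡⟨ cong₂ ℤ._-_ u≡ i≡i' ⟩
  (i' ℤ.+ j') ℤ.- i'      ≡⟨ j-from-u i' j' ⟨
  j'                      ∎)
  where
  open ≡-Reasoning
  2i-from-u-v : ∀ i j → + 2 ℤ.* i ≡ (i ℤ.+ j) ℤ.+ (i ℤ.- j)
  2i-from-u-v = ℤ-Solver.solve-∀
  j-from-u : ∀ i j → j ≡ (i ℤ.+ j) ℤ.- i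
  j-from-u = ℤ-Solver.solve-∀
  i≡i' : i ≡ i'
  i≡i' = ℤ.*-cancelˡ-≡ (+ 2) i i'
    (trans (2i-from-u-v i j) (trans (cong₂ ℤ._+_ u≡ v≡) (sym (2i-from-u-v i' j'))))

centres-anticode : ∀ {r ℓ A} → IsAnticode r A → IsAnticode (r + 2 * ℓ) (λ c → Meets c ℓ A)
centres-anticode {r} {ℓ} anti c c' (p , p∈A , cp≤ℓ) (p' , p'∈A , c'p'≤ℓ) = begin
  dist c c'                           ≤⟨ dist-triangle c p c' ⟩
  dist c p + dist p c'                ≤⟨ +-monoʳ-≤ (dist c p) (dist-triangle p p' c') ⟩
  dist c p + (dist p p' + dist p' c') ≤⟨ +-mono-≤ cp≤ℓ (+-mono-≤ (anti p p' p∈A p'∈A) p'c'≤ℓ) ⟩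
  ℓ + (r + ℓ)                         ≡⟨ regroup r ℓ ⟩
  r + 2 * ℓ                           ∎
  where
  open ≤-Reasoning
  p'c'≤ℓ : dist p' c' ≤ ℓ
  p'c'≤ℓ = subst (_≤ ℓ) (dist-sym c' p') c'p'≤ℓ
  regroup : ∀ r ℓ → ℓ + (r + ℓ) ≡ r + 2 * ℓ
  regroup = ℕ-Solver.solve-∀

offset-gap : ∀ {m x y} → m ℤ.≤ x → m ℤ.≤ y → + ∣ m ℤ.- x ∣ ℤ.- + ∣ m ℤ.- y ∣ ≡ x ℤ.- y
offset-gap {m} {x} {y} m≤x m≤y = begin
  + ∣ m ℤ.- x ∣ ℤ.- + ∣ m ℤ.- y ∣ ≡⟨ cong₂ ℤ._-_ (ℤ.∣-∣-≤ m≤x) (ℤ.∣-∣-≤ m≤y) ⟩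
  (x ℤ.- m) ℤ.- (y ℤ.- m)         ≡⟨ cancel x y m ⟩
  x ℤ.- y                          ∎
  where
  open ≡-Reasoning
  cancel : ∀ x y m → (x ℤ.- m) ℤ.- (y ℤ.- m) ≡ x ℤ.- y
  cancel = ℤ-Solver.solve-∀

offset-injective : ∀ {m x y} → m ℤ.≤ x → m ℤ.≤ y → ∣ m ℤ.- x ∣ ≡ ∣ m ℤ.- y ∣ → x ≡ y
offset-injective {m} {x} {y} m≤x m≤y eq =
  ℤ.i-j≡0⇒i≡j x y (trans (sym (offset-gap m≤x m≤y)) (ℤ.i≡j⇒i-j≡0 (cong +_ eq)))

%2-cong : ∀ b b' (k : ℤ) → + b ℤ.- + b' ≡ + 2 ℤ.* k → b % 2 ≡ b' % 2
%2-cong b b' (+ k) gap = begin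
  b % 2            ≡⟨ cong (_% 2) b≡b'+k*2 ⟩
  (b' + k * 2) % 2 ≡⟨ [m+kn]%n≡m%n b' k 2 ⟩
  b' % 2           ∎
  where
  open ≡-Reasoning
  shift : ∀ x y → x ≡ y ℤ.+ (x ℤ.- y)
  shift = ℤ-Solver.solve-∀
  b≡b'+k*2 : b ≡ b' + k * 2
  b≡b'+k*2 = ℤ.+-injective (begin
    + b                      ≡⟨ shift (+ b) (+ b') ⟩
    + b' ℤ.+ (+ b ℤ.- + b')  ≡⟨ cong (ℤ._+_ (+ b')) gap ⟩
    + b' ℤ.+ + 2 ℤ.* + k     ≡⟨ cong (ℤ._+_ (+ b')) (sym (ℤ.pos-* 2 k)) ⟩
    + (b' + 2 * k)           ≡⟨ cong (λ t → + (b' + t)) (*-comm 2 k) ⟩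
    + (b' + k * 2)           ∎)
%2-cong b b' -[1+ k ] gap = sym (%2-cong b' b (+ suc k) (begin
  + b' ℤ.- + b                  ≡⟨ swap (+ b) (+ b') ⟩
  ℤ.- (+ b ℤ.- + b')            ≡⟨ cong ℤ.-_ gap ⟩
  ℤ.- (+ 2 ℤ.* -[1+ k ])        ≡⟨ ℤ.neg-distribʳ-* (+ 2) -[1+ k ] ⟩
  + 2 ℤ.* + suc k               ∎))
  where
  open ≡-Reasoning
  swap : ∀ x y → y ℤ.- x ≡ ℤ.- (x ℤ.- y)
  swap = ℤ-Solver.solve-∀

half-injective : ∀ {b b'} (k : ℤ) → + b ℤ.- + b' ≡ + 2 ℤ.* k → b / 2 ≡ b' / 2 → b ≡ b'
half-injective {b} {b'} k gap halves = begin
  b                   ≡⟨ m≡m%n+[m/n]*n b 2 ⟩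
  b % 2 + b / 2 * 2   ≡⟨ cong₂ (λ s q → s + q * 2) (%2-cong b b' k gap) halves ⟩
  b' % 2 + b' / 2 * 2 ≡⟨ m≡m%n+[m/n]*n b' 2 ⟨
  b'                  ∎
  where open ≡-Reasoning

lookup-injective : ∀ {A : Set} {xs : List A} → Unique xs → Injective _≡_ _≡_ (lookup xs)
lookup-injective {xs = _ ∷ _} _          {fzero}  {fzero}  _ = refl
lookup-injective              (x∉xs ∷ _) {fzero}  {fsuc j} x≡xⱼ = contradiction x≡xⱼ (All.lookup x∉xs (∈-lookup j))
lookup-injective              (x∉xs ∷ _) {fsuc i} {fzero}  xᵢ≡x = contradiction (sym xᵢ≡x) (All.lookup x∉xs (∈-lookup i))
lookup-injective              (_ ∷ xs-distinct)  {fsuc i} {fsuc j} xᵢ≡xⱼ = cong fsuc (lookup-injective xs-distinct xᵢ≡xⱼ)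

length≤-of-grid-injection : ∀ {A : Set} {xs : List A} {m n} → Unique xs → (key : A → ℕ × ℕ) →
  (∀ {x} → x ∈ xs → proj₁ (key x) < m × proj₂ (key x) < n) →
  (∀ {x y} → x ∈ xs → y ∈ xs → key x ≡ key y → x ≡ y) →
  length xs ≤ m * n
length≤-of-grid-injection {xs = xs} {m} {n} distinct key bounded injective = injective⇒≤ cell-injective
  where
  cell : Fin (length xs) → Fin (m * n)
  cell i = combine (fromℕ< (proj₁ (bounded (∈-lookup i)))) (fromℕ< (proj₂ (bounded (∈-lookup i))))
  cell-injective : Injective _≡_ _≡_ cell
  cell-injective {i} {j} eq with combine-injective {m} {n} _ _ _ _ eq
  ... | eq₁ , eq₂ = lookup-injective distinct (injective (∈-lookup i) (∈-lookup j)
          (cong₂ _,_ (fromℕ<-injective (proj₁ (key (lookup xs i))) _ _ _ eq₁)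
                     (fromℕ<-injective (proj₂ (key (lookup xs i))) _ _ _ eq₂)))

floor-of-nonExpanding : ∀ {f D x xs} → NonExpanding f → IsAnticode D (_∈ x ∷ xs) →
  ∃[ m ] (∀ {c} → c ∈ x ∷ xs → m ℤ.≤ f c × ∣ m ℤ.- f c ∣ ≤ D)
floor-of-nonExpanding {f} {D} {x} {xs} f-nonExpanding diam =
  f p₀ , λ c∈ → All.lookup minimal c∈ , ≤-trans (f-nonExpanding _ p₀) (diam _ p₀ c∈ p₀∈)
  where
  p₀ : Point
  p₀ = argmin f x xs
  p₀∈ : p₀ ∈ x ∷ xs
  p₀∈ with argmin-sel f x xs
  ... | inj₁ p₀≡x  = here p₀≡x
  ... | inj₂ p₀∈xs = there p₀∈xs
  minimal : All (λ c → f p₀ ℤ.≤ f c) (x ∷ xs)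
  minimal = f[argmin]≤f[⊤] {f = f} x xs ∷ f[argmin]≤f[xs] {f = f} x xs

anticode-length≤ : ∀ D {cs : List Point} → Unique cs → IsAnticode D (_∈ cs) →
  length cs ≤ suc D * suc (D / 2)
anticode-length≤ D {[]}     _        _    = z≤n
anticode-length≤ D {x ∷ xs} distinct diam
  with floor-of-nonExpanding u-nonExpanding diam | floor-of-nonExpanding v-nonExpanding diam
... | m , u-above | n , v-above = length≤-of-grid-injection distinct key key-bounded key-injective
  where
  a b : Point → ℕ
  a c = ∣ m ℤ.- u c ∣
  b c = ∣ n ℤ.- v c ∣
  key : Point → ℕ × ℕ
  key c = a c , b c / 2
  key-bounded : ∀ {c} → c ∈ x ∷ xs → a c < suc D × b c / 2 < suc (D / 2)
  key-bounded c∈ = s≤s (proj₂ (u-above c∈)) , s≤s (/-monoˡ-≤ 2 (proj₂ (v-above c∈)))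
  key-injective : ∀ {c c'} → c ∈ x ∷ xs → c' ∈ x ∷ xs → key c ≡ key c' → c ≡ c'
  key-injective {c} {c'} c∈ c'∈ eq = u-v-injective u≡ v≡
    where
    u≡ : u c ≡ u c'
    u≡ = offset-injective (proj₁ (u-above c∈)) (proj₁ (u-above c'∈)) (,-injectiveˡ eq)
    b≡ : b c ≡ b c'
    b≡ = half-injective _
           (trans (offset-gap (proj₁ (v-above c∈)) (proj₁ (v-above c'∈))) (v-gap-on-u-line {c} {c'} u≡))
           (,-injectiveʳ eq)
    v≡ : v c ≡ v c'
    v≡ = offset-injective (proj₁ (v-above c∈)) (proj₁ (v-above c'∈)) b≡

2*[1+D]*[1+D/2]≤D²+3D+2 : ∀ D → 2 * (suc D * suc (D / 2)) ≤ D ^ 2 + 3 * D + 2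
2*[1+D]*[1+D/2]≤D²+3D+2 D = begin
  2 * (suc D * suc (D / 2))  ≡⟨ distribute D (D / 2) ⟩
  suc D * (2 + D / 2 * 2)    ≤⟨ *-monoʳ-≤ (suc D) (+-monoʳ-≤ 2 (m/n*n≤m D 2)) ⟩
  suc D * (2 + D)            ≡⟨ expand D ⟩
  D * D + 3 * D + 2          ≡⟨ cong (λ t → D * t + 3 * D + 2) (*-identityʳ D) ⟨
  D ^ 2 + 3 * D + 2          ∎
  where
  open ≤-Reasoning
  distribute : ∀ D h → 2 * (suc D * suc h) ≡ suc D * (2 + h * 2)
  distribute = ℕ-Solver.solve-∀
  expand : ∀ D → suc D * (2 + D) ≡ D * D + 3 * D + 2
  expand = ℕ-Solver.solve-∀

3*[r+2ℓ]+2≤12r : ∀ {r ℓ} → 1 ≤ ℓ → ℓ ≤ r → 3 * (r + 2 * ℓ) + 2 ≤ 2 * 6 * r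
3*[r+2ℓ]+2≤12r {r} {ℓ} 1≤ℓ ℓ≤r = begin
  3 * (r + 2 * ℓ) + 2        ≤⟨ +-mono-≤ (*-monoʳ-≤ 3 (+-monoʳ-≤ r (*-monoʳ-≤ 2 ℓ≤r))) (*-monoʳ-≤ 2 (≤-trans 1≤ℓ ℓ≤r)) ⟩
  3 * (r + 2 * r) + 2 * r    ≤⟨ m≤m+n _ r ⟩
  3 * (r + 2 * r) + 2 * r + r ≡⟨ collect r ⟩
  2 * 6 * r                  ∎
  where
  open ≤-Reasoning
  collect : ∀ r → 3 * (r + 2 * r) + 2 * r + r ≡ 2 * 6 * r
  collect = ℕ-Solver.solve-∀

centres-of-meeting-spheres-bound : ∀ (r ℓ : ℕ) (A : Pred Point 0ℓ) → IsAnticode r A → 1 ≤ ℓ → ℓ ≤ r →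
  ∀ (cs : List Point) → Unique cs → All (λ c → Meets c ℓ A) cs →
  2 * length cs ≤ (r + 2 * ℓ) ^ 2 + 2 * 6 * r
centres-of-meeting-spheres-bound r ℓ A anti 1≤ℓ ℓ≤r cs distinct meets = begin
  2 * length cs                ≤⟨ *-monoʳ-≤ 2 (anticode-length≤ D distinct centres-close) ⟩
  2 * (suc D * suc (D / 2))    ≤⟨ 2*[1+D]*[1+D/2]≤D²+3D+2 D ⟩
  D ^ 2 + 3 * D + 2            ≡⟨ +-assoc (D ^ 2) (3 * D) 2 ⟩
  D ^ 2 + (3 * D + 2)          ≤⟨ +-monoʳ-≤ (D ^ 2) (3*[r+2ℓ]+2≤12r 1≤ℓ ℓ≤r) ⟩
  D ^ 2 + 2 * 6 * r            ∎
  where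
  open ≤-Reasoning
  D : ℕ
  D = r + 2 * ℓ
  centres-close : IsAnticode D (_∈ cs)
  centres-close c c' c∈ c'∈ = centres-anticode anti c c' (All.lookup meets c∈) (All.lookup meets c'∈)

lemma2 : ∃[ C ] (∀ (r ℓ : ℕ) (A : Pred Point 0ℓ) → IsAnticode r A → 1 ≤ ℓ → ℓ ≤ r →
           ∀ (cs : List Point) → Unique cs → All (λ c → Meets c ℓ A) cs →
           2 * length cs ≤ (r + 2 * ℓ) ^ 2 + 2 * C * r)
lemma2 = 6 , centres-of-meeting-spheres-bound
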